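{- Let $B$ be a directed bipartite graph with vertex parts $L$ and $R$ in which every edge is oriented from $L$ to $R$, and let $\mathcal{D}(B)$ be the directed multi-graph constructed from $B$ as described in the context, with source $s$ and sink $t$. For $u\in L$ and $v\in R$: upon insertion of an edge $(s,v)$ and an edge $(u,t)$ into $\mathcal{D}(B)$, the capacity of an $(s,t)$-mincut in $\mathcal{D}(B)$ increases by exactly $1$ if and only if the edge $(u,v)$ is present in $B$.
   Context: Construction of $\mathcal{D}(B)$: the vertex set is $L\cup R\cup\{s,t\}$ (with $s,t$ new vertices); include every edge of $B$ (oriented $L\to R$); for each $u\in L$ with $p>0$ outgoing edges in $B$ add $p$ edges from $s$ to $u$; for each $u\in R$ with $p>0$ incoming edges in $B$ add $p$ edges from $u$ to $t$; additionally for each $u\in L\cup R$ add one edge from $s$ to $u$ and one edge from $u$ to $t$. An $(s,t)$-cut is a set $C$ with $s\in C$, $t\notin C$; its capacity is the number of edges leaving $C$; an $(s,t)$-mincut is an $(s,t)$-cut of minimum capacity. -}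

module Defs where

open import Data.Nat using (ℕ; zero; suc; _+_; _*_; _≤_)
open import Data.Bool using (Bool; true; false; if_then_else_; _∧_; not)
open import Data.Fin using (Fin)
open import Data.Fin.Properties using () renaming (_≟_ to _≟F_)
open import Data.List using (List; _∷_; []; map; _++_; allFin; concatMap)
open import Data.Nat.ListAction using (sum)
open import Data.Product using (Σ; _×_; _,_)
open import Relation.Binary.PropositionalEquality using (_≡_)
open import Relation.Nullary using (does)

BipGraph : ℕ → ℕ → Set
BipGraph l r = Fin l → Fin r → Bool

data Vtx (l r : ℕ) : Set where
  src : Vtx l r
  snk : Vtx l r
  lft : Fin l → Vtx l r
  rgt : Fin r → Vtx l r

allVtx : (l r : ℕ) → List (Vtx l r)
allVtx l r = src ∷ snk ∷ (map lft (allFin l) ++ map rgt (allFin r))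

eqV : {l r : ℕ} → Vtx l r → Vtx l r → Bool
eqV src src = true
eqV snk snk = true
eqV (lft i) (lft j) = does (i ≟F j)
eqV (rgt i) (rgt j) = does (i ≟F j)
eqV _ _ = false

MultiGraph : ℕ → ℕ → Set
MultiGraph l r = Vtx l r → Vtx l r → ℕ

ind : Bool → ℕ
ind true = 1
ind false = 0

outdeg : {l r : ℕ} → BipGraph l r → Fin l → ℕ
outdeg {l} {r} B u = sum (map (λ v → ind (B u v)) (allFin r))

indeg : {l r : ℕ} → BipGraph l r → Fin r → ℕ
indeg {l} {r} B v = sum (map (λ u → ind (B u v)) (allFin l))

-- The multigraph D(B) of the context:
--  * edges of B (L → R);
--  * p = outdeg u edges s → u for u ∈ L (zero when p = 0), plus one extra s → u;
--  * p = indeg v edges v → t for v ∈ R, plus one extra v → t;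
--  * one extra edge s → v for v ∈ R and u → t for u ∈ L.
D : {l r : ℕ} → BipGraph l r → MultiGraph l r
D B (lft u) (rgt v) = ind (B u v)
D B src (lft u) = suc (outdeg B u)
D B src (rgt v) = 1
D B (lft u) snk = 1
D B (rgt v) snk = suc (indeg B v)
D B _ _ = 0

addEdge : {l r : ℕ} → Vtx l r → Vtx l r → MultiGraph l r → MultiGraph l r
addEdge a b G x y = G x y + ind (eqV x a ∧ eqV y b)

record Cut (l r : ℕ) : Set where
  field
    mem    : Vtx l r → Bool
    hasSrc : mem src ≡ true
    noSnk  : mem snk ≡ false

capacity : {l r : ℕ} → MultiGraph l r → Cut l r → ℕ
capacity {l} {r} G C =
  sum (concatMap (λ x → map (λ y → ind (mem x ∧ not (mem y)) * G x y) (allVtx l r)) (allVtx l r))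
  where open Cut C

IsMinCutCapacity : {l r : ℕ} → MultiGraph l r → ℕ → Set
IsMinCutCapacity {l} {r} G k =
  Σ (Cut l r) (λ C → capacity G C ≡ k) × ((C : Cut l r) → k ≤ capacity G C)

-- D(B) is the edge-disjoint union of the paths s → x → t (x ∈ L ∪ R) and s → i → j → t (ij ∈ B).
-- A cut C crosses each of them exactly once, except that s → i → j → t is crossed twice when
-- i ∉ C and j ∈ C.  So the capacity of C is |L| + |R| + |B| plus the number of such backward
-- edges ij, and the minimum |L| + |R| + |B| is attained by C = V ∖ {t}.  The new edges s → v and
-- u → t add [v ∉ C] + [u ∈ C].  If uv ∈ B, every cut pays at least one extra unit (for a new
-- edge or for uv being backward) and C = {s} pays exactly one; otherwise
-- C = {s} ∪ (L ∖ {u}) ∪ {v} pays nothing extra.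
module Submission where

open import Defs
open import Data.Nat using (ℕ; zero; suc; _+_; _*_; _≤_)
open import Data.Nat.Properties
  using (+-*-semiring; +-commutativeSemigroup; +-identityʳ; +-comm; *-identityʳ; *-zeroʳ; *-comm; *-suc;
         *-distribˡ-+; +-assoc; m≤m+n; m≤n+m; m<m+n; ≤-trans; ≤-antisym; <-irrefl)
open import Data.Bool using (Bool; true; false; _∧_; not)
open import Data.Bool.Properties using (∧-identityʳ)
open import Data.Fin using (Fin; punchIn)
open import Data.Fin.Properties using (punchInᵢ≢i) renaming (_≟_ to _≟F_)
open import Data.List using (List; []; _∷_; map; _++_; allFin; tabulate; concat)
import Data.List.Properties as List
import Data.Nat.ListAction as List
open import Data.Nat.ListAction.Properties using (sum-++)
open import Data.Product using (_,_; proj₂)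
open import Function using (_∘_; id; const)
open import Function.Bundles using (_⇔_; mk⇔)
open import Relation.Binary.PropositionalEquality
open import Relation.Nullary using (does; yes; no; contradiction)
open import Relation.Nullary.Decidable using (dec-true; dec-false)
open import Algebra.Properties.Semiring.Sum +-*-semiring
  using (sum; sum-syntax; sum-cong-≗; sum-replicate-zero; sum-remove; ∑-distrib-+; ∑-comm)
open import Algebra.Properties.CommutativeSemigroup +-commutativeSemigroup
  using (interchange; x∙yz≈y∙xz)

open ≡-Reasoning

sum-tabulate : ∀ {n} (f : Fin n → ℕ) → List.sum (tabulate f) ≡ ∑[ i < n ] f i
sum-tabulate {zero}  f = refl
sum-tabulate {suc n} f = cong (f Fin.zero +_) (sum-tabulate (f ∘ Fin.suc))

sum-allFin : ∀ {n} (f : Fin n → ℕ) → List.sum (map f (allFin n)) ≡ ∑[ i < n ] f i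
sum-allFin f = trans (cong List.sum (List.map-tabulate id f)) (sum-tabulate f)

sum-concat : (xss : List (List ℕ)) → List.sum (concat xss) ≡ List.sum (map List.sum xss)
sum-concat []         = refl
sum-concat (xs ∷ xss) = trans (sum-++ xs (concat xss)) (cong (List.sum xs +_) (sum-concat xss))

∑-zero : ∀ {n} {f : Fin n → ℕ} → (∀ i → f i ≡ 0) → ∑[ i < n ] f i ≡ 0
∑-zero {n} f≗0 = trans (sum-cong-≗ f≗0) (sum-replicate-zero n)

∑∑-zero : ∀ {m n} {f : Fin m → Fin n → ℕ} → (∀ i j → f i j ≡ 0) → ∑[ i < m ] ∑[ j < n ] f i j ≡ 0
∑∑-zero f≗0 = ∑-zero (λ i → ∑-zero (f≗0 i))

∑∑-distrib-+ : ∀ {m n} (f g : Fin m → Fin n → ℕ) →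
  ∑[ i < m ] ∑[ j < n ] (f i j + g i j) ≡ ∑[ i < m ] ∑[ j < n ] f i j + ∑[ i < m ] ∑[ j < n ] g i j
∑∑-distrib-+ {n = n} f g =
  trans (sum-cong-≗ (λ i → ∑-distrib-+ (f i) (g i))) (∑-distrib-+ (λ i → ∑[ j < n ] f i j) (λ i → ∑[ j < n ] g i j))

∑-suc : ∀ n (f : Fin n → ℕ) → ∑[ i < n ] suc (f i) ≡ n + ∑[ i < n ] f i
∑-suc zero    f = refl
∑-suc (suc n) f = cong suc (trans (cong (f Fin.zero +_) (∑-suc n (f ∘ Fin.suc))) (x∙yz≈y∙xz (f Fin.zero) n _))

summand≤∑ : ∀ {n} (f : Fin n → ℕ) (i : Fin n) → f i ≤ ∑[ k < n ] f k
summand≤∑ {suc n} f i = subst (f i ≤_) (sym (sum-remove f)) (m≤m+n (f i) _)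

∑-single : ∀ {n} (f : Fin n → ℕ) (i : Fin n) → (∀ k → k ≢ i → f k ≡ 0) → ∑[ k < n ] f k ≡ f i
∑-single {suc n} f i others = begin
  sum f                         ≡⟨ sum-remove f ⟩
  f i + sum (f ∘ punchIn i)     ≡⟨ cong (f i +_) (∑-zero (λ k → others (punchIn i k) (punchInᵢ≢i i k))) ⟩
  f i + 0                       ≡⟨ +-identityʳ (f i) ⟩
  f i                           ∎

-- Edges of the path s → i → j → t leaving a cut that contains i iff a and j iff z.
pathCrossings : Bool → Bool → ℕ
pathCrossings a z = ind (not a) + ind (a ∧ not z) + ind z

pathCrossings≡1+backward : ∀ a z → pathCrossings a z ≡ suc (ind (not a ∧ z))
pathCrossings≡1+backward false false = refl
pathCrossings≡1+backward false true  = refl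
pathCrossings≡1+backward true  false = refl
pathCrossings≡1+backward true  true  = refl

module _ {l r : ℕ} where

  ∑V : (Vtx l r → ℕ) → ℕ
  ∑V F = F src + (F snk + (∑[ i < l ] F (lft i) + ∑[ j < r ] F (rgt j)))

  sum-allVtx : (F : Vtx l r → ℕ) → List.sum (map F (allVtx l r)) ≡ ∑V F
  sum-allVtx F = cong (λ s → F src + (F snk + s)) (begin
    List.sum (map F (map lft (allFin l) ++ map rgt (allFin r)))
      ≡⟨ cong List.sum (List.map-++ F (map lft (allFin l)) _) ⟩
    List.sum (map F (map lft (allFin l)) ++ map F (map rgt (allFin r)))
      ≡⟨ sum-++ (map F (map lft (allFin l))) _ ⟩
    List.sum (map F (map lft (allFin l))) + List.sum (map F (map rgt (allFin r)))
      ≡⟨ cong₂ _+_ (sum-map-∘-allFin lft) (sum-map-∘-allFin rgt) ⟩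
    ∑[ i < l ] F (lft i) + ∑[ j < r ] F (rgt j) ∎)
    where
    sum-map-∘-allFin : ∀ {n} (g : Fin n → Vtx l r) → List.sum (map F (map g (allFin n))) ≡ ∑[ i < n ] F (g i)
    sum-map-∘-allFin {n} g = trans (cong List.sum (sym (List.map-∘ {g = F} {f = g} (allFin n)))) (sum-allFin (F ∘ g))

  ∑V-cong : {F G : Vtx l r → ℕ} → (∀ x → F x ≡ G x) → ∑V F ≡ ∑V G
  ∑V-cong F≗G = cong₂ _+_ (F≗G src) (cong₂ _+_ (F≗G snk)
                  (cong₂ _+_ (sum-cong-≗ (F≗G ∘ lft)) (sum-cong-≗ (F≗G ∘ rgt))))

  ∑V-zero : ∑V (const 0) ≡ 0
  ∑V-zero = cong₂ _+_ (sum-replicate-zero l) (sum-replicate-zero r)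

  ∑V-distrib-+ : (F G : Vtx l r → ℕ) → ∑V (λ x → F x + G x) ≡ ∑V F + ∑V G
  ∑V-distrib-+ F G = begin
    (F src + G src) + ((F snk + G snk) + (∑[ i < l ] (F (lft i) + G (lft i)) + ∑[ j < r ] (F (rgt j) + G (rgt j))))
      ≡⟨ cong (λ s → (F src + G src) + ((F snk + G snk) + s))
           (trans (cong₂ _+_ (∑-distrib-+ (F ∘ lft) (G ∘ lft)) (∑-distrib-+ (F ∘ rgt) (G ∘ rgt)))
                  (interchange (∑[ i < l ] F (lft i)) _ _ _)) ⟩
    (F src + G src) + ((F snk + G snk) + (∑ᴸᴿ F + ∑ᴸᴿ G))
      ≡⟨ cong ((F src + G src) +_) (interchange (F snk) (G snk) _ _) ⟩
    (F src + G src) + ((F snk + ∑ᴸᴿ F) + (G snk + ∑ᴸᴿ G))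
      ≡⟨ interchange (F src) (G src) _ _ ⟩
    ∑V F + ∑V G ∎
    where
    ∑ᴸᴿ : (Vtx l r → ℕ) → ℕ
    ∑ᴸᴿ H = ∑[ i < l ] H (lft i) + ∑[ j < r ] H (rgt j)

  eqV-refl : (x : Vtx l r) → eqV x x ≡ true
  eqV-refl src     = refl
  eqV-refl snk     = refl
  eqV-refl (lft i) = dec-true (i ≟F i) refl
  eqV-refl (rgt j) = dec-true (j ≟F j) refl

  ∑V-parts : (F : Vtx l r → ℕ) {a b c d : ℕ} → F src ≡ a → F snk ≡ b →
    ∑[ i < l ] F (lft i) ≡ c → ∑[ j < r ] F (rgt j) ≡ d → ∑V F ≡ a + (b + (c + d))
  ∑V-parts F a b c d = cong₂ _+_ a (cong₂ _+_ b (cong₂ _+_ c d))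

  ∑V-single : (F : Vtx l r → ℕ) (a : Vtx l r) → (∀ x → eqV x a ≡ false → F x ≡ 0) → ∑V F ≡ F a
  ∑V-single F src off =
    trans (∑V-parts F refl (off snk refl) (∑-zero (λ i → off (lft i) refl)) (∑-zero (λ j → off (rgt j) refl)))
          (+-identityʳ (F src))
  ∑V-single F snk off =
    trans (∑V-parts F (off src refl) refl (∑-zero (λ i → off (lft i) refl)) (∑-zero (λ j → off (rgt j) refl)))
          (+-identityʳ (F snk))
  ∑V-single F (lft u) off =
    trans (∑V-parts F (off src refl) (off snk refl)
                    (∑-single (F ∘ lft) u (λ i i≢u → off (lft i) (dec-false (i ≟F u) i≢u)))
                    (∑-zero (λ j → off (rgt j) refl)))
          (+-identityʳ (F (lft u)))
  ∑V-single F (rgt v) off =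
    ∑V-parts F (off src refl) (off snk refl) (∑-zero (λ i → off (lft i) refl))
             (∑-single (F ∘ rgt) v (λ j j≢v → off (rgt j) (dec-false (j ≟F v) j≢v)))

  cutValue : MultiGraph l r → (Vtx l r → Bool) → ℕ
  cutValue G m = ∑V (λ x → ∑V (λ y → ind (m x ∧ not (m y)) * G x y))

  capacity≡cutValue : (G : MultiGraph l r) (C : Cut l r) → capacity G C ≡ cutValue G (Cut.mem C)
  capacity≡cutValue G C = begin
    List.sum (concat (map row V))              ≡⟨ sum-concat (map row V) ⟩
    List.sum (map List.sum (map row V))        ≡⟨ cong List.sum (List.map-∘ {g = List.sum} {f = row} V) ⟨
    List.sum (map (List.sum ∘ row) V)          ≡⟨ cong List.sum (List.map-cong (λ x → sum-allVtx (crossing x)) V) ⟩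
    List.sum (map (λ x → ∑V (crossing x)) V)   ≡⟨ sum-allVtx (λ x → ∑V (crossing x)) ⟩
    cutValue G (Cut.mem C)                     ∎
    where
    open Cut C
    V = allVtx l r
    crossing : Vtx l r → Vtx l r → ℕ
    crossing x y = ind (mem x ∧ not (mem y)) * G x y
    row : Vtx l r → List ℕ
    row x = map (crossing x) V

  cutValue-cong : (G : MultiGraph l r) {m m′ : Vtx l r → Bool} →
    (∀ x → m x ≡ m′ x) → cutValue G m ≡ cutValue G m′
  cutValue-cong G m≗m′ =
    ∑V-cong (λ x → ∑V-cong (λ y → cong₂ (λ a b → ind (a ∧ not b) * G x y) (m≗m′ x) (m≗m′ y)))

  cutValue-+ : (G H : MultiGraph l r) (m : Vtx l r → Bool) →
    cutValue (λ x y → G x y + H x y) m ≡ cutValue G m + cutValue H m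
  cutValue-+ G H m = trans (∑V-cong (λ x → trans (∑V-cong (λ y → *-distribˡ-+ (c x y) (G x y) (H x y)))
                                                 (∑V-distrib-+ (λ y → c x y * G x y) (λ y → c x y * H x y))))
                           (∑V-distrib-+ (λ x → ∑V (λ y → c x y * G x y)) (λ x → ∑V (λ y → c x y * H x y)))
    where
    c : Vtx l r → Vtx l r → ℕ
    c x y = ind (m x ∧ not (m y))

  singleEdge : Vtx l r → Vtx l r → MultiGraph l r
  singleEdge a b x y = ind (eqV x a ∧ eqV y b)

  cutValue-singleEdge : (a b : Vtx l r) (m : Vtx l r → Bool) → cutValue (singleEdge a b) m ≡ ind (m a ∧ not (m b))
  cutValue-singleEdge a b m = begin
    cutValue (singleEdge a b) m
      ≡⟨ ∑V-single _ a row-off-a ⟩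
    ∑V (λ y → c a y * ind (eqV a a ∧ eqV y b))
      ≡⟨ ∑V-cong (λ y → cong (λ e → c a y * ind (e ∧ eqV y b)) (eqV-refl a)) ⟩
    ∑V (λ y → c a y * ind (eqV y b))
      ≡⟨ ∑V-single _ b (λ y y≢b → trans (cong (λ e → c a y * ind e) y≢b) (*-zeroʳ (c a y))) ⟩
    c a b * ind (eqV b b)
      ≡⟨ cong (λ e → c a b * ind e) (eqV-refl b) ⟩
    c a b * 1
      ≡⟨ *-identityʳ (c a b) ⟩
    c a b ∎
    where
    c : Vtx l r → Vtx l r → ℕ
    c x y = ind (m x ∧ not (m y))
    row-off-a : ∀ x → eqV x a ≡ false → ∑V (λ y → c x y * ind (eqV x a ∧ eqV y b)) ≡ 0
    row-off-a x x≢a =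
      trans (∑V-cong (λ y → trans (cong (λ e → c x y * ind (e ∧ eqV y b)) x≢a) (*-zeroʳ (c x y)))) ∑V-zero

  cutValue-addEdge : (a b : Vtx l r) (G : MultiGraph l r) (m : Vtx l r → Bool) →
    cutValue (addEdge a b G) m ≡ cutValue G m + ind (m a ∧ not (m b))
  cutValue-addEdge a b G m = trans (cutValue-+ G (singleEdge a b) m) (cong (cutValue G m +_) (cutValue-singleEdge a b m))

  -- Every cut has this form up to the proofs about s and t, and here membership of s and t computes.
  side : (Fin l → Bool) → (Fin r → Bool) → Vtx l r → Bool
  side A Z src     = true
  side A Z snk     = false
  side A Z (lft i) = A i
  side A Z (rgt j) = Z j

  cutOf : (Fin l → Bool) → (Fin r → Bool) → Cut l r
  cutOf A Z = record { mem = side A Z ; hasSrc = refl ; noSnk = refl }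

  capacity≡cutValue-side : (G : MultiGraph l r) (C : Cut l r) →
    capacity G C ≡ cutValue G (side (Cut.mem C ∘ lft) (Cut.mem C ∘ rgt))
  capacity≡cutValue-side G C = trans (capacity≡cutValue G C) (cutValue-cong G mem≗side)
    where
    open Cut C
    mem≗side : ∀ x → mem x ≡ side (mem ∘ lft) (mem ∘ rgt) x
    mem≗side src     = hasSrc
    mem≗side snk     = noSnk
    mem≗side (lft i) = refl
    mem≗side (rgt j) = refl

  uvCut : Fin l → Fin r → Cut l r
  uvCut u v = cutOf (λ i → not (does (i ≟F u))) (λ j → does (j ≟F v))

  minCutCapacity-unique : {G : MultiGraph l r} {k k′ : ℕ} → IsMinCutCapacity G k → IsMinCutCapacity G k′ → k ≡ k′
  minCutCapacity-unique ((C , refl) , k≤) ((C′ , refl) , k′≤) = ≤-antisym (k≤ C′) (k′≤ C)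

  module _ (B : BipGraph l r) where

    edgeCount : ℕ
    edgeCount = ∑[ i < l ] ∑[ j < r ] ind (B i j)

    backEdges : (Fin l → Bool) → (Fin r → Bool) → ℕ
    backEdges A Z = ∑[ i < l ] ∑[ j < r ] (ind (B i j) * ind (not (A i) ∧ Z j))

    minCap : ℕ
    minCap = l + r + edgeCount

    module _ (A : Fin l → Bool) (Z : Fin r → Bool) where

      -- The edges s → i are grouped with the edges leaving i, and likewise for j ∈ R.
      source+row-lft : ∀ i (a : Bool) →
        ind (not a) * suc (outdeg B i) + ∑V (λ y → ind (a ∧ not (side A Z y)) * D B (lft i) y)
          ≡ suc (∑[ j < r ] (ind (B i j) * (ind (not a) + ind (a ∧ not (Z j)))))
      source+row-lft i false = begin
        (suc (outdeg B i) + 0) + ∑V (const 0)    ≡⟨ cong₂ _+_ (+-identityʳ _) ∑V-zero ⟩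
        suc (outdeg B i) + 0                    ≡⟨ +-identityʳ _ ⟩
        suc (outdeg B i)                        ≡⟨ cong suc (sum-allFin (λ j → ind (B i j))) ⟩
        suc (∑[ j < r ] ind (B i j))            ≡⟨ cong suc (sum-cong-≗ (λ j → *-identityʳ (ind (B i j)))) ⟨
        suc (∑[ j < r ] (ind (B i j) * 1))      ∎
      source+row-lft i true = cong suc (begin
        ∑[ k < l ] (ind (not (A k)) * 0) + ∑[ j < r ] (ind (not (Z j)) * ind (B i j))
          ≡⟨ cong (_+ _) (∑-zero (λ k → *-zeroʳ (ind (not (A k))))) ⟩
        ∑[ j < r ] (ind (not (Z j)) * ind (B i j))
          ≡⟨ sum-cong-≗ (λ j → *-comm (ind (not (Z j))) (ind (B i j))) ⟩
        ∑[ j < r ] (ind (B i j) * ind (not (Z j))) ∎)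

      source+row-rgt : ∀ j (z : Bool) →
        ind (not z) * 1 + ∑V (λ y → ind (z ∧ not (side A Z y)) * D B (rgt j) y)
          ≡ suc (∑[ i < l ] (ind (B i j) * ind z))
      source+row-rgt j false = cong suc (trans ∑V-zero (sym (∑-zero (λ i → *-zeroʳ (ind (B i j))))))
      source+row-rgt j true = begin
        (suc (indeg B j) + 0) + (∑[ i < l ] (ind (not (A i)) * 0) + ∑[ k < r ] (ind (not (Z k)) * 0))
          ≡⟨ cong₂ _+_ (+-identityʳ _) (cong₂ _+_ (∑-zero (λ i → *-zeroʳ (ind (not (A i)))))
                                                   (∑-zero (λ k → *-zeroʳ (ind (not (Z k)))))) ⟩
        suc (indeg B j) + 0                     ≡⟨ +-identityʳ _ ⟩
        suc (indeg B j)                         ≡⟨ cong suc (sum-allFin (λ i → ind (B i j))) ⟩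
        suc (∑[ i < l ] ind (B i j))            ≡⟨ cong suc (sum-cong-≗ (λ i → *-identityʳ (ind (B i j)))) ⟨
        suc (∑[ i < l ] (ind (B i j) * 1))      ∎

      cutValue-D-paths : cutValue (D B) (side A Z) ≡ l + r + ∑[ i < l ] ∑[ j < r ] (ind (B i j) * pathCrossings (A i) (Z j))
      cutValue-D-paths = begin
        (∑[ i < l ] s i + ∑[ j < r ] t j) + (∑V (const 0) + (∑[ i < l ] row (lft i) + ∑[ j < r ] row (rgt j)))
          ≡⟨ cong ((∑[ i < l ] s i + ∑[ j < r ] t j) +_) (cong (_+ (∑[ i < l ] row (lft i) + ∑[ j < r ] row (rgt j))) ∑V-zero) ⟩
        (∑[ i < l ] s i + ∑[ j < r ] t j) + (∑[ i < l ] row (lft i) + ∑[ j < r ] row (rgt j))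
          ≡⟨ interchange (∑[ i < l ] s i) _ _ _ ⟩
        (∑[ i < l ] s i + ∑[ i < l ] row (lft i)) + (∑[ j < r ] t j + ∑[ j < r ] row (rgt j))
          ≡⟨ cong₂ _+_ (∑-distrib-+ s (row ∘ lft)) (∑-distrib-+ t (row ∘ rgt)) ⟨
        ∑[ i < l ] (s i + row (lft i)) + ∑[ j < r ] (t j + row (rgt j))
          ≡⟨ cong₂ _+_ (sum-cong-≗ (λ i → source+row-lft i (A i))) (sum-cong-≗ (λ j → source+row-rgt j (Z j))) ⟩
        ∑[ i < l ] suc (∑[ j < r ] P i j) + ∑[ j < r ] suc (∑[ i < l ] Q i j)
          ≡⟨ cong₂ _+_ (∑-suc l (λ i → ∑[ j < r ] P i j)) (∑-suc r (λ j → ∑[ i < l ] Q i j)) ⟩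
        (l + ∑[ i < l ] ∑[ j < r ] P i j) + (r + ∑[ j < r ] ∑[ i < l ] Q i j)
          ≡⟨ cong (λ z → (l + ∑[ i < l ] ∑[ j < r ] P i j) + (r + z)) (∑-comm Q) ⟨
        (l + ∑[ i < l ] ∑[ j < r ] P i j) + (r + ∑[ i < l ] ∑[ j < r ] Q i j)
          ≡⟨ interchange l _ r _ ⟩
        l + r + (∑[ i < l ] ∑[ j < r ] P i j + ∑[ i < l ] ∑[ j < r ] Q i j)
          ≡⟨ cong (l + r +_) (∑∑-distrib-+ P Q) ⟨
        l + r + ∑[ i < l ] ∑[ j < r ] (P i j + Q i j)
          ≡⟨ cong (l + r +_) (sum-cong-≗ (λ i → sum-cong-≗ (λ j →
               *-distribˡ-+ (ind (B i j)) (ind (not (A i)) + ind (A i ∧ not (Z j))) (ind (Z j))))) ⟨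
        l + r + ∑[ i < l ] ∑[ j < r ] (ind (B i j) * pathCrossings (A i) (Z j)) ∎
        where
        row : Vtx l r → ℕ
        row x = ∑V (λ y → ind (side A Z x ∧ not (side A Z y)) * D B x y)
        s : Fin l → ℕ
        s i = ind (not (A i)) * suc (outdeg B i)
        t : Fin r → ℕ
        t j = ind (not (Z j)) * 1
        P Q : Fin l → Fin r → ℕ
        P i j = ind (B i j) * (ind (not (A i)) + ind (A i ∧ not (Z j)))
        Q i j = ind (B i j) * ind (Z j)

      cutValue-D : cutValue (D B) (side A Z) ≡ minCap + backEdges A Z
      cutValue-D = begin
        cutValue (D B) (side A Z)
          ≡⟨ cutValue-D-paths ⟩
        l + r + ∑[ i < l ] ∑[ j < r ] (ind (B i j) * pathCrossings (A i) (Z j))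
          ≡⟨ cong (l + r +_) (sum-cong-≗ (λ i → sum-cong-≗ (λ j →
               trans (cong (ind (B i j) *_) (pathCrossings≡1+backward (A i) (Z j)))
                     (*-suc (ind (B i j)) (ind (not (A i) ∧ Z j)))))) ⟩
        l + r + ∑[ i < l ] ∑[ j < r ] (ind (B i j) + ind (B i j) * ind (not (A i) ∧ Z j))
          ≡⟨ cong (l + r +_) (∑∑-distrib-+ (λ i j → ind (B i j)) (λ i j → ind (B i j) * ind (not (A i) ∧ Z j))) ⟩
        l + r + (edgeCount + backEdges A Z)
          ≡⟨ +-assoc (l + r) edgeCount (backEdges A Z) ⟨
        minCap + backEdges A Z ∎

    capacity-D : (C : Cut l r) → capacity (D B) C ≡ minCap + backEdges (Cut.mem C ∘ lft) (Cut.mem C ∘ rgt)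
    capacity-D C = trans (capacity≡cutValue-side (D B) C) (cutValue-D (Cut.mem C ∘ lft) (Cut.mem C ∘ rgt))

    backEdges-none : (A : Fin l → Bool) (Z : Fin r → Bool) →
      (∀ i j → not (A i) ∧ Z j ≡ true → B i j ≡ false) → backEdges A Z ≡ 0
    backEdges-none A Z noBackward = ∑∑-zero summand≡0
      where
      summand≡0 : ∀ i j → ind (B i j) * ind (not (A i) ∧ Z j) ≡ 0
      summand≡0 i j with not (A i) ∧ Z j in backward
      ... | false = *-zeroʳ (ind (B i j))
      ... | true rewrite noBackward i j backward = refl

    backEdges-≥1 : ∀ A Z i j → B i j ≡ true → A i ≡ false → Z j ≡ true → 1 ≤ backEdges A Z
    backEdges-≥1 A Z i j Bij Ai Zj =
      subst (_≤ backEdges A Z) summand≡1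
        (≤-trans (summand≤∑ (λ k → ind (B i k) * ind (not (A i) ∧ Z k)) j)
                 (summand≤∑ (λ k → ∑[ m < r ] (ind (B k m) * ind (not (A k) ∧ Z m))) i))
      where
      summand≡1 : ind (B i j) * ind (not (A i) ∧ Z j) ≡ 1
      summand≡1 rewrite Bij | Ai | Zj = refl

    D-minCut : IsMinCutCapacity (D B) minCap
    D-minCut = (fullCut , fullCut-capacity) , λ C → subst (minCap ≤_) (sym (capacity-D C)) (m≤m+n minCap _)
      where
      fullCut : Cut l r
      fullCut = cutOf (const true) (const true)
      fullCut-capacity : capacity (D B) fullCut ≡ minCap
      fullCut-capacity = trans (capacity-D fullCut)
        (trans (cong (minCap +_) (backEdges-none (const true) (const true) (λ _ _ ()))) (+-identityʳ minCap))

    module _ (u : Fin l) (v : Fin r) where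

      D⁺ : MultiGraph l r
      D⁺ = addEdge (lft u) snk (addEdge src (rgt v) (D B))

      cutValue-D⁺ : ∀ A Z → cutValue D⁺ (side A Z) ≡ minCap + (backEdges A Z + ind (not (Z v)) + ind (A u))
      cutValue-D⁺ A Z = begin
        cutValue D⁺ (side A Z)
          ≡⟨ cutValue-addEdge (lft u) snk (addEdge src (rgt v) (D B)) (side A Z) ⟩
        cutValue (addEdge src (rgt v) (D B)) (side A Z) + ind (A u ∧ true)
          ≡⟨ cong₂ _+_ (cutValue-addEdge src (rgt v) (D B) (side A Z)) (cong ind (∧-identityʳ (A u))) ⟩
        cutValue (D B) (side A Z) + ind (not (Z v)) + ind (A u)
          ≡⟨ cong (λ c → c + ind (not (Z v)) + ind (A u)) (cutValue-D A Z) ⟩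
        minCap + backEdges A Z + ind (not (Z v)) + ind (A u)
          ≡⟨ cong (_+ ind (A u)) (+-assoc minCap (backEdges A Z) (ind (not (Z v)))) ⟩
        minCap + (backEdges A Z + ind (not (Z v))) + ind (A u)
          ≡⟨ +-assoc minCap _ (ind (A u)) ⟩
        minCap + (backEdges A Z + ind (not (Z v)) + ind (A u)) ∎

      capacity-D⁺ : (C : Cut l r) → let open Cut C in
        capacity D⁺ C ≡ minCap + (backEdges (mem ∘ lft) (mem ∘ rgt) + ind (not (mem (rgt v))) + ind (mem (lft u)))
      capacity-D⁺ C = trans (capacity≡cutValue-side D⁺ C) (cutValue-D⁺ (Cut.mem C ∘ lft) (Cut.mem C ∘ rgt))

      uvEdge⇒cut-pays-extra : B u v ≡ true → ∀ A Z → 1 ≤ backEdges A Z + ind (not (Z v)) + ind (A u)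
      uvEdge⇒cut-pays-extra Buv A Z with A u in Au | Z v in Zv
      ... | true  | _     = m≤n+m 1 _
      ... | false | false = ≤-trans (m≤n+m 1 (backEdges A Z)) (m≤m+n _ 0)
      ... | false | true  = ≤-trans (≤-trans (backEdges-≥1 A Z u v Buv Au Zv) (m≤m+n _ 0)) (m≤m+n _ 0)

      D⁺-minCut : B u v ≡ true → IsMinCutCapacity D⁺ (suc minCap)
      D⁺-minCut Buv = (sourceCut , sourceCut-capacity) ,
                      λ C → subst (suc minCap ≤_) (sym (capacity-D⁺ C))
                                  (m<m+n minCap (uvEdge⇒cut-pays-extra Buv (Cut.mem C ∘ lft) (Cut.mem C ∘ rgt)))
        where
        sourceCut : Cut l r
        sourceCut = cutOf (const false) (const false)
        sourceCut-capacity : capacity D⁺ sourceCut ≡ suc minCap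
        sourceCut-capacity = trans (capacity-D⁺ sourceCut)
          (trans (cong (λ b → minCap + (b + 1 + 0)) (backEdges-none (const false) (const false) (λ _ _ ())))
                 (+-comm minCap 1))

      noUVEdge⇒uvCut-capacity : B u v ≡ false → capacity D⁺ (uvCut u v) ≡ minCap
      noUVEdge⇒uvCut-capacity Buv = begin
        capacity D⁺ (uvCut u v)
          ≡⟨ capacity-D⁺ (uvCut u v) ⟩
        minCap + (backEdges uvL uvR + ind (not (does (v ≟F v))) + ind (not (does (u ≟F u))))
          ≡⟨ cong (minCap +_) (cong₂ _+_ (cong₂ _+_ (backEdges-none uvL uvR onlyUV)
                                                    (cong (ind ∘ not) (dec-true (v ≟F v) refl)))
                                         (cong (ind ∘ not) (dec-true (u ≟F u) refl))) ⟩
        minCap + 0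
          ≡⟨ +-identityʳ minCap ⟩
        minCap ∎
        where
        uvL : Fin l → Bool
        uvL i = not (does (i ≟F u))
        uvR : Fin r → Bool
        uvR j = does (j ≟F v)
        onlyUV : ∀ i j → not (uvL i) ∧ uvR j ≡ true → B i j ≡ false
        onlyUV i j with i ≟F u | j ≟F v
        ... | yes refl | yes refl = λ _ → Buv
        ... | yes _    | no _     = λ ()
        ... | no _     | _        = λ ()

lemma106 : {l r : ℕ} (B : BipGraph l r) (u : Fin l) (v : Fin r) (k k′ : ℕ) →
    IsMinCutCapacity (D B) k →
    IsMinCutCapacity (addEdge (lft u) snk (addEdge src (rgt v) (D B))) k′ →
    (k′ ≡ suc k) ⇔ (B u v ≡ true)
lemma106 B u v k k′ minCutD minCutD⁺ = mk⇔ edge-present edge-raises-minCut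
  where
  k≡minCap : k ≡ minCap B
  k≡minCap = minCutCapacity-unique minCutD (D-minCut B)

  edge-raises-minCut : B u v ≡ true → k′ ≡ suc k
  edge-raises-minCut Buv = trans (minCutCapacity-unique minCutD⁺ (D⁺-minCut B u v Buv)) (cong suc (sym k≡minCap))

  edge-present : k′ ≡ suc k → B u v ≡ true
  edge-present k′≡1+k with B u v in Buv
  ... | true  = refl
  ... | false = contradiction (subst (_≤ k) k′≡1+k k′≤k) (<-irrefl refl)
    where
    k′≤k : k′ ≤ k
    k′≤k = subst (k′ ≤_) (trans (noUVEdge⇒uvCut-capacity B u v Buv) (sym k≡minCap)) (proj₂ minCutD⁺ (uvCut u v))
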